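{- Let $F$ be a field, $\lambda\ge 0$ an integer, and $A_1,\dots,A_n$ $\lambda$-null finite subsets of $F$. Assume that $f\in F[X_1,\dots,X_n]$ satisfies \[\deg(f)\leq(|A_1|-1)+\dots+(|A_n|-1)+\lambda,\] and that the coefficient of $X_1^{|A_1|-1}\cdots X_n^{|A_n|-1}$ in $f$ is zero. Then $f$ cannot vanish at all but exactly one point of the grid $A_1\times\dots\times A_n$ (i.e., it is impossible that $f(a)\neq0$ for exactly one grid point $a$).
   Context: For a finite non-empty $A\subseteq F$, $\Pi_A(X)=\prod_{a\in A}(X-a)$; $A$ is $\lambda$-null (for $\lambda\in\{0,\dots,|A|\}$) if in $\Pi_A(X)$ the coefficients of $X^{|A|-1},\dots,X^{|A|-\lambda}$ vanish. $\deg(f)$ is the total degree. -}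

module Defs where

open import Level using (Level; _⊔_)
open import Algebra.Bundles using (CommutativeRing)
open import Data.Nat as ℕ using (ℕ; zero; suc; _∸_)
open import Data.Fin using (Fin; zero; suc)
open import Data.Vec as Vec using (Vec)
open import Data.Vec.Properties using (≡-dec)
open import Data.List as List using (List; []; _∷_; length)
open import Data.List.Relation.Unary.AllPairs using (AllPairs)
open import Data.Product using (_×_; _,_; ∃; ∃-syntax)
open import Relation.Nullary using (¬_; yes; no)
open import Relation.Binary.PropositionalEquality using (_≡_; _≢_)

sumFin : (n : ℕ) → (Fin n → ℕ) → ℕ
sumFin zero    g = 0
sumFin (suc n) g = g zero ℕ.+ sumFin n (λ i → g (suc i))

module FieldDefs {c ℓ : Level} (R : CommutativeRing c ℓ) where
  open CommutativeRing R hiding (zero)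

  record IsField : Set (c ⊔ ℓ) where
    field
      0≉1 : ¬ (0# ≈ 1#)
      inverse : ∀ x → ¬ (x ≈ 0#) → ∃[ y ] (x * y ≈ 1#)

  -- Univariate polynomials: coefficient lists, lowest degree first.
  UPoly : Set c
  UPoly = List Carrier

  _⊕_ : UPoly → UPoly → UPoly
  []      ⊕ q       = q
  (x ∷ p) ⊕ []      = x ∷ p
  (x ∷ p) ⊕ (y ∷ q) = (x + y) ∷ (p ⊕ q)

  mulXminus : Carrier → UPoly → UPoly
  mulXminus a p = (0# ∷ p) ⊕ List.map (λ z → (- a) * z) p

  ΠA : List Carrier → UPoly
  ΠA []      = 1# ∷ []
  ΠA (a ∷ A) = mulXminus a (ΠA A)

  ucoeff : UPoly → ℕ → Carrier
  ucoeff []      k       = 0#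
  ucoeff (x ∷ p) zero    = x
  ucoeff (x ∷ p) (suc k) = ucoeff p k

  -- a finite subset of F: a list of pairwise distinct elements
  Distinct : List Carrier → Set (c ⊔ ℓ)
  Distinct = AllPairs (λ x y → ¬ (x ≈ y))

  IsNull : ℕ → List Carrier → Set (c ⊔ ℓ)
  IsNull lam A =
    (A ≢ []) × (lam ℕ.≤ length A) ×
    (∀ j → 1 ℕ.≤ j → j ℕ.≤ lam → ucoeff (ΠA A) (length A ∸ j) ≈ 0#)

  -- Multivariate polynomials in X_1..X_n: finite lists of terms
  -- (coefficient, exponent vector); like monomials are summed.
  Poly : ℕ → Set c
  Poly n = List (Carrier × Vec ℕ n)

  coeff : ∀ {n} → Poly n → Vec ℕ n → Carrier
  coeff []            m = 0#
  coeff ((a , e) ∷ f) m with ≡-dec ℕ._≟_ e m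
  ... | yes _ = a + coeff f m
  ... | no  _ = coeff f m

  mdeg : ∀ {n} → Vec ℕ n → ℕ
  mdeg = Vec.foldr _ ℕ._+_ 0

  DegLe : ∀ {n} → Poly n → ℕ → Set ℓ
  DegLe {n} f d = ∀ (m : Vec ℕ n) → ¬ (coeff f m ≈ 0#) → mdeg m ℕ.≤ d

  _^_ : Carrier → ℕ → Carrier
  x ^ zero  = 1#
  x ^ suc k = x * (x ^ k)

  prodFin : (n : ℕ) → (Fin n → Carrier) → Carrier
  prodFin zero    g = 1#
  prodFin (suc n) g = g zero * prodFin n (λ i → g (suc i))

  eval : ∀ {n} → Poly n → (Fin n → Carrier) → Carrier
  eval []            x = 0#
  eval {n} ((a , e) ∷ f) x = a * prodFin n (λ i → x i ^ Vec.lookup e i) + eval f x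

  -- Grid A_1 × … × A_n; a grid point is given by choosing an index
  -- into each A_i.
  Choice : ∀ {n} → (Fin n → List Carrier) → Set
  Choice {n} A = (i : Fin n) → Fin (length (A i))

  point : ∀ {n} (A : Fin n → List Carrier) → Choice A → Fin n → Carrier
  point A σ i = List.lookup (A i) (σ i)

  ExactlyOneNonzero : ∀ {n} → (Fin n → List Carrier) → Poly n → Set ℓ
  ExactlyOneNonzero A f =
    ∃[ σ ] (¬ (eval f (point A σ) ≈ 0#) ×
            (∀ τ → ¬ (eval f (point A τ) ≈ 0#) → ∀ i → point A τ i ≈ point A σ i))

-- For each A take the Lagrange weights w(a) = 1 / ∏_{b ∈ A, b ≠ a} (a - b). Their power sums
-- S(m) = Σ_a w(a) a^m are divided differences of X^m: they vanish for m < |A| - 1 and equal 1 at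
-- m = |A| - 1. Expanding 0 = Σ_a w(a) a^k Π_A(a), λ-nullity extends the vanishing to
-- |A| - 1 < m ≤ |A| - 1 + λ. So on monomials of degree ≤ Σ (|A_i| - 1) + λ the weighted grid sum
-- Σ_a w(a_1)⋯w(a_n) a^e is the indicator of e = (|A_i| - 1)_i, and the weighted grid sum of f is
-- that coefficient of f, namely 0; but if f were nonzero at exactly one grid point, the sum would
-- be a single nonzero term. Equality in F is not decidable, so that f vanishes off the point and
-- that coefficients above the degree bound vanish are only known doubly negated, which suffices
-- for a negative conclusion.

module Submission where

open import Defs
open import Level using (Level)
open import Algebra.Bundles using (CommutativeRing)
open import Data.Nat as ℕ using (ℕ; zero; suc; _∸_; _⊔_; _<_; _≤_; z≤n; s≤s)
import Data.Nat.Properties as ℕₚ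
open import Data.Fin using (Fin; zero; suc; toℕ; inject₁; fromℕ; punchIn)
import Data.Fin.Properties as Finₚ
open import Data.Vec as Vec using (Vec; []; _∷_; tabulate)
open import Data.Vec.Properties using (≡-dec)
open import Data.List as List using (List; []; _∷_; length; lookup; removeAt)
import Data.List.Properties as Listₚ
open import Data.List.Relation.Unary.All as All using (_∷_)
open import Data.List.Membership.Propositional.Properties using (∈-lookup)
open import Data.List.Relation.Unary.AllPairs using (_∷_)
open import Data.Product using (_,_; proj₁; proj₂; Σ; ∃-syntax)
open import Data.Empty using (⊥-elim)
open import Effect.Monad using (RawMonad)
open import Function using (_∘_)
open import Relation.Nullary using (¬_; yes; no)
open import Relation.Nullary.Negation using (¬¬-Monad; contradiction)
open import Relation.Binary.Definitions using (tri<; tri≈; tri>)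
import Relation.Binary.PropositionalEquality as ≡
open ≡ using (_≡_; _≢_)

module CoefficientFormula {c ℓ : Level} (R : CommutativeRing c ℓ) where

  open CommutativeRing R hiding (zero)
  open FieldDefs R
  open import Algebra.Properties.Semiring.Sum semiring
    using (sum; sum-syntax; sum-cong-≋; sum-replicate-zero; sum-init-last; sum-remove; ∑-distrib-+; ∑-comm;
           *-distribˡ-sum; *-distribʳ-sum)
  open import Algebra.Properties.Ring ring using (-‿distribˡ-*)
  open import Algebra.Properties.Group +-group using (∙-cancelʳ; x≈y⇒x∙y⁻¹≈ε; x∙y⁻¹≈ε⇒x≈y)
  open import Algebra.Properties.CommutativeSemigroup *-commutativeSemigroup using (x∙yz≈y∙xz)
  open import Algebra.Solver.Ring.NaturalCoefficients.Default commutativeSemiring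
  open import Relation.Binary.Reasoning.Setoid setoid
  open RawMonad (¬¬-Monad {a = ℓ}) using (pure; _<$>_; zipWith)

  x≈0⇒x*y≈0 : ∀ {x} y → x ≈ 0# → x * y ≈ 0#
  x≈0⇒x*y≈0 y x≈0 = trans (*-congʳ x≈0) (zeroˡ y)

  y≈0⇒x*y≈0 : ∀ x {y} → y ≈ 0# → x * y ≈ 0#
  y≈0⇒x*y≈0 x y≈0 = trans (*-congˡ y≈0) (zeroʳ x)

  sum-≈0 : ∀ {n} (t : Fin n → Carrier) → (∀ i → t i ≈ 0#) → sum t ≈ 0#
  sum-≈0 {n} t t≈0 = trans (sum-cong-≋ t≈0) (sum-replicate-zero n)

  ^-homo-* : ∀ x m n → x ^ (m ℕ.+ n) ≈ x ^ m * x ^ n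
  ^-homo-* x zero    n = sym (*-identityˡ _)
  ^-homo-* x (suc m) n = trans (*-congˡ (^-homo-* x m n)) (sym (*-assoc _ _ _))

  ^-congˡ : ∀ {x y} m → x ≈ y → x ^ m ≈ y ^ m
  ^-congˡ zero    x≈y = refl
  ^-congˡ (suc m) x≈y = *-cong x≈y (^-congˡ m x≈y)

  prodFin-cong : ∀ n {g h : Fin n → Carrier} → (∀ i → g i ≈ h i) → prodFin n g ≈ prodFin n h
  prodFin-cong zero    g≈h = refl
  prodFin-cong (suc n) g≈h = *-cong (g≈h zero) (prodFin-cong n (g≈h ∘ suc))

  prodFin-* : ∀ n (g h : Fin n → Carrier) → prodFin n g * prodFin n h ≈ prodFin n (λ i → g i * h i)
  prodFin-* zero    g h = *-identityˡ 1#
  prodFin-* (suc n) g h = trans (solve 4 (λ a b c d → (a :* b) :* (c :* d) := (a :* c) :* (b :* d)) refl _ _ _ _)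
                                (*-congˡ (prodFin-* n (g ∘ suc) (h ∘ suc)))

  ueval : UPoly → Carrier → Carrier
  ueval []      z = 0#
  ueval (a ∷ p) z = a + z * ueval p z

  ueval-⊕ : ∀ p q z → ueval (p ⊕ q) z ≈ ueval p z + ueval q z
  ueval-⊕ []      q       z = sym (+-identityˡ _)
  ueval-⊕ (a ∷ p) []      z = sym (+-identityʳ _)
  ueval-⊕ (a ∷ p) (b ∷ q) z = trans (+-congˡ (*-congˡ (ueval-⊕ p q z)))
    (solve 5 (λ a b z u v → (a :+ b) :+ z :* (u :+ v) := (a :+ z :* u) :+ (b :+ z :* v)) refl a b z _ _)

  ueval-scale : ∀ k p z → ueval (List.map (k *_) p) z ≈ k * ueval p z
  ueval-scale k []      z = sym (zeroʳ k)
  ueval-scale k (a ∷ p) z = trans (+-congˡ (*-congˡ (ueval-scale k p z)))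
    (solve 4 (λ k a z u → k :* a :+ z :* (k :* u) := k :* (a :+ z :* u)) refl k a z _)

  ueval-mulXminus : ∀ a p z → ueval (mulXminus a p) z ≈ (z - a) * ueval p z
  ueval-mulXminus a p z = begin
    ueval (mulXminus a p) z                              ≈⟨ ueval-⊕ (0# ∷ p) (List.map (- a *_) p) z ⟩
    (0# + z * ueval p z) + ueval (List.map (- a *_) p) z ≈⟨ +-cong (+-identityˡ _) (ueval-scale (- a) p z) ⟩
    z * ueval p z + - a * ueval p z                      ≈⟨ distribʳ _ z (- a) ⟨
    (z - a) * ueval p z                                  ∎

  ueval-ΠA-lookup : ∀ A j → ueval (ΠA A) (lookup A j) ≈ 0#
  ueval-ΠA-lookup (a ∷ A) zero    = trans (ueval-mulXminus a (ΠA A) a) (x≈0⇒x*y≈0 _ (-‿inverseʳ a))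
  ueval-ΠA-lookup (a ∷ A) (suc j) = trans (ueval-mulXminus a (ΠA A) _) (y≈0⇒x*y≈0 _ (ueval-ΠA-lookup A j))

  ueval-expansion : ∀ p z {n} → length p ≤ n → ueval p z ≈ ∑[ i < n ] (ucoeff p (toℕ i) * z ^ toℕ i)
  ueval-expansion []      z {n}     _         = sym (sum-≈0 {n} _ (λ i → zeroˡ _))
  ueval-expansion (a ∷ p) z {suc n} (s≤s len≤n) = +-cong (sym (*-identityʳ a)) (begin
    z * ueval p z                                   ≈⟨ *-congˡ (ueval-expansion p z len≤n) ⟩
    z * ∑[ i < n ] (ucoeff p (toℕ i) * z ^ toℕ i)   ≈⟨ *-distribˡ-sum {n} z _ ⟩
    ∑[ i < n ] (z * (ucoeff p (toℕ i) * z ^ toℕ i)) ≈⟨ sum-cong-≋ {n} (λ i → x∙yz≈y∙xz z _ _) ⟩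
    ∑[ i < n ] (ucoeff p (toℕ i) * (z * z ^ toℕ i)) ∎)

  length-⊕ : ∀ p q → length (p ⊕ q) ≡ length p ⊔ length q
  length-⊕ []      q       = ≡.refl
  length-⊕ (a ∷ p) []      = ≡.refl
  length-⊕ (a ∷ p) (b ∷ q) = ≡.cong suc (length-⊕ p q)

  length-ΠA : ∀ A → length (ΠA A) ≡ suc (length A)
  length-ΠA []      = ≡.refl
  length-ΠA (a ∷ A) = ≡.trans (length-⊕ (0# ∷ ΠA A) (List.map (- a *_) (ΠA A)))
    (≡.trans (ℕₚ.m≥n⇒m⊔n≡m (ℕₚ.≤-trans map≤ (ℕₚ.n≤1+n _))) (≡.cong suc (length-ΠA A)))
    where
    map≤ : length (List.map (- a *_) (ΠA A)) ≤ length (ΠA A)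
    map≤ = ℕₚ.≤-reflexive (Listₚ.length-map (- a *_) (ΠA A))

  ucoeff-⊕ : ∀ p q i → ucoeff (p ⊕ q) i ≈ ucoeff p i + ucoeff q i
  ucoeff-⊕ []      q       i       = sym (+-identityˡ _)
  ucoeff-⊕ (a ∷ p) []      i       = sym (+-identityʳ _)
  ucoeff-⊕ (a ∷ p) (b ∷ q) zero    = refl
  ucoeff-⊕ (a ∷ p) (b ∷ q) (suc i) = ucoeff-⊕ p q i

  ucoeff-scale : ∀ k p i → ucoeff (List.map (k *_) p) i ≈ k * ucoeff p i
  ucoeff-scale k []      i       = sym (zeroʳ k)
  ucoeff-scale k (a ∷ p) zero    = refl
  ucoeff-scale k (a ∷ p) (suc i) = ucoeff-scale k p i

  ucoeff-≥length : ∀ p {i} → length p ≤ i → ucoeff p i ≈ 0#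
  ucoeff-≥length []      _           = refl
  ucoeff-≥length (a ∷ p) (s≤s len≤i) = ucoeff-≥length p len≤i

  ucoeff-ΠA-length : ∀ A → ucoeff (ΠA A) (length A) ≈ 1#
  ucoeff-ΠA-length []      = refl
  ucoeff-ΠA-length (a ∷ A) = begin
    ucoeff (ΠA (a ∷ A)) (suc (length A))
      ≈⟨ ucoeff-⊕ (0# ∷ ΠA A) (List.map (- a *_) (ΠA A)) (suc (length A)) ⟩
    ucoeff (ΠA A) (length A) + ucoeff (List.map (- a *_) (ΠA A)) (suc (length A))
      ≈⟨ +-cong (ucoeff-ΠA-length A) (ucoeff-scale (- a) (ΠA A) (suc (length A))) ⟩
    1# + - a * ucoeff (ΠA A) (suc (length A))
      ≈⟨ +-congˡ (y≈0⇒x*y≈0 (- a) (ucoeff-≥length (ΠA A) (ℕₚ.≤-reflexive (length-ΠA A)))) ⟩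
    1# + 0#
      ≈⟨ +-identityʳ 1# ⟩
    1# ∎

  nullCoefficient : ∀ {lam} A → IsNull lam A →
    ∀ {i} → length A ∸ lam ≤ i → i < length A → ucoeff (ΠA A) i ≈ 0#
  nullCoefficient {lam} A (_ , lam≤N , null) {i} N∸lam≤i i<N =
    ≡.subst (λ t → ucoeff (ΠA A) t ≈ 0#) (ℕₚ.m∸[m∸n]≡n (ℕₚ.<⇒≤ i<N)) (null (N ∸ i) (ℕₚ.m<n⇒0<n∸m i<N) N∸i≤lam)
    where
    N = length A
    N∸i≤lam : N ∸ i ≤ lam
    N∸i≤lam = ≡.subst (N ∸ i ≤_) (ℕₚ.m∸[m∸n]≡n lam≤N) (ℕₚ.∸-monoʳ-≤ N N∸lam≤i)

  -- Lagrange weights and their power sums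

  lookup-≉-removeAt : ∀ A → Distinct A → ∀ j k → lookup A j ≉ lookup (removeAt A j) k
  lookup-≉-removeAt (x ∷ B) (x≉B ∷ _)       zero    k       = All.lookup x≉B (∈-lookup k)
  lookup-≉-removeAt (x ∷ B) (x≉B ∷ _)       (suc j) zero    = All.lookup x≉B (∈-lookup j) ∘ sym
  lookup-≉-removeAt (x ∷ B) (_ ∷ distinctB) (suc j) (suc k) = lookup-≉-removeAt B distinctB j k

  lookup-injective : ∀ A → Distinct A → ∀ {j k} → lookup A j ≈ lookup A k → j ≡ k
  lookup-injective (x ∷ B) _               {zero}  {zero}  _   = ≡.refl
  lookup-injective (x ∷ B) (x≉B ∷ _)       {zero}  {suc k} x≈b = ⊥-elim (All.lookup x≉B (∈-lookup k) x≈b)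
  lookup-injective (x ∷ B) (x≉B ∷ _)       {suc j} {zero}  b≈x = ⊥-elim (All.lookup x≉B (∈-lookup j) (sym b≈x))
  lookup-injective (x ∷ B) (_ ∷ distinctB) {suc j} {suc k} b≈b = ≡.cong suc (lookup-injective B distinctB b≈b)

  lagrangeDenominator : (A : List Carrier) → Fin (length A) → Carrier
  lagrangeDenominator A j = prodFin _ (λ k → lookup A j - lookup (removeAt A j) k)

  IsLagrangeWeight : (A : List Carrier) → (Fin (length A) → Carrier) → Set ℓ
  IsLagrangeWeight A w = ∀ j → w j * lagrangeDenominator A j ≈ 1#

  powerSum : (A : List Carrier) → (Fin (length A) → Carrier) → ℕ → Carrier
  powerSum A w m = ∑[ j < length A ] (w j * lookup A j ^ m)

  tailWeights : ∀ x B → (Fin (length (x ∷ B)) → Carrier) → Fin (length B) → Carrier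
  tailWeights x B w j = w (suc j) * (lookup B j - x)

  tailWeights-isLagrange : ∀ {x B w} → IsLagrangeWeight (x ∷ B) w → IsLagrangeWeight B (tailWeights x B w)
  tailWeights-isLagrange wt j = trans (*-assoc _ _ _) (wt (suc j))

  swap₀₁ : ∀ {n} → (Fin (suc (suc n)) → Carrier) → Fin (suc (suc n)) → Carrier
  swap₀₁ w zero          = w (suc zero)
  swap₀₁ w (suc zero)    = w zero
  swap₀₁ w (suc (suc j)) = w (suc (suc j))

  swap₀₁-isLagrange : ∀ {x y C w} →
    IsLagrangeWeight (x ∷ y ∷ C) w → IsLagrangeWeight (y ∷ x ∷ C) (swap₀₁ w)
  swap₀₁-isLagrange wt zero          = wt (suc zero)
  swap₀₁-isLagrange wt (suc zero)    = wt zero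
  swap₀₁-isLagrange wt (suc (suc j)) = trans (*-congˡ (x∙yz≈y∙xz _ _ _)) (wt (suc (suc j)))

  powerSum-swap₀₁ : ∀ x y C w m → powerSum (y ∷ x ∷ C) (swap₀₁ w) m ≈ powerSum (x ∷ y ∷ C) w m
  powerSum-swap₀₁ x y C w m = solve 3 (λ a b s → b :+ (a :+ s) := a :+ (b :+ s)) refl _ _ _

  -- Divided-difference recursion: write each b ∈ B as x + (b - x).
  powerSum-suc : ∀ x B w m →
    powerSum (x ∷ B) w (suc m) ≈ x * powerSum (x ∷ B) w m + powerSum B (tailWeights x B w) m
  powerSum-suc x B w m = begin
    w zero * (x * x ^ m) + ∑[ j < length B ] (w (suc j) * (b j * b j ^ m))
      ≈⟨ +-cong (x∙yz≈y∙xz (w zero) x (x ^ m)) (sum-cong-≋ {length B} split) ⟩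
    x * (w zero * x ^ m) + ∑[ j < length B ] (x * (w (suc j) * b j ^ m) + tailWeights x B w j * b j ^ m)
      ≈⟨ +-congˡ (∑-distrib-+ {length B} _ _) ⟩
    x * (w zero * x ^ m) + (∑[ j < length B ] (x * (w (suc j) * b j ^ m)) + powerSum B (tailWeights x B w) m)
      ≈⟨ +-congˡ (+-congʳ (*-distribˡ-sum {length B} x _)) ⟨
    x * (w zero * x ^ m) + (x * ∑[ j < length B ] (w (suc j) * b j ^ m) + powerSum B (tailWeights x B w) m)
      ≈⟨ +-assoc _ _ _ ⟨
    (x * (w zero * x ^ m) + x * ∑[ j < length B ] (w (suc j) * b j ^ m)) + powerSum B (tailWeights x B w) m
      ≈⟨ +-congʳ (distribˡ x _ _) ⟨
    x * powerSum (x ∷ B) w m + powerSum B (tailWeights x B w) m ∎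
    where
    b = lookup B
    split : ∀ j → w (suc j) * (b j * b j ^ m) ≈ x * (w (suc j) * b j ^ m) + tailWeights x B w j * b j ^ m
    split j = sym (begin
      x * (v * p) + (v * (b j - x)) * p  ≈⟨ regroup x v p (b j) (- x) ⟩
      v * (b j * p) + (v * p) * (x - x)  ≈⟨ +-congˡ (y≈0⇒x*y≈0 (v * p) (-‿inverseʳ x)) ⟩
      v * (b j * p) + 0#                 ≈⟨ +-identityʳ _ ⟩
      v * (b j * p)                      ∎)
      where
      v = w (suc j)
      p = b j ^ m
      regroup : ∀ x v p b nx → x * (v * p) + (v * (b + nx)) * p ≈ v * (b * p) + (v * p) * (x + nx)
      regroup = solve 5 (λ x v p b nx → x :* (v :* p) :+ (v :* (b :+ nx)) :* p
                                       := v :* (b :* p) :+ (v :* p) :* (x :+ nx)) refl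

  powerSum-ueval : ∀ A w k p {n} → length p ≤ n →
    ∑[ j < length A ] (w j * (lookup A j ^ k * ueval p (lookup A j)))
      ≈ ∑[ i < n ] (ucoeff p (toℕ i) * powerSum A w (k ℕ.+ toℕ i))
  powerSum-ueval A w k p {n} len≤n = begin
    ∑[ j < length A ] (w j * (a j ^ k * ueval p (a j)))
      ≈⟨ sum-cong-≋ {length A} (λ j → *-congˡ (*-congˡ (ueval-expansion p (a j) len≤n))) ⟩
    ∑[ j < length A ] (w j * (a j ^ k * ∑[ i < n ] (ucoeff p (toℕ i) * a j ^ toℕ i)))
      ≈⟨ sum-cong-≋ {length A} (λ j → trans (*-congˡ (*-distribˡ-sum {n} (a j ^ k) _))
                                            (*-distribˡ-sum {n} (w j) _)) ⟩
    ∑[ j < length A ] ∑[ i < n ] (w j * (a j ^ k * (ucoeff p (toℕ i) * a j ^ toℕ i)))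
      ≈⟨ sum-cong-≋ {length A} (λ j → sum-cong-≋ {n} (λ i → regroup (w j) (a j) (ucoeff p (toℕ i)) (toℕ i))) ⟩
    ∑[ j < length A ] ∑[ i < n ] (ucoeff p (toℕ i) * (w j * a j ^ (k ℕ.+ toℕ i)))
      ≈⟨ ∑-comm {length A} {n} _ ⟩
    ∑[ i < n ] ∑[ j < length A ] (ucoeff p (toℕ i) * (w j * a j ^ (k ℕ.+ toℕ i)))
      ≈⟨ sum-cong-≋ {n} (λ i → *-distribˡ-sum {length A} (ucoeff p (toℕ i)) _) ⟨
    ∑[ i < n ] (ucoeff p (toℕ i) * powerSum A w (k ℕ.+ toℕ i)) ∎
    where
    a = lookup A
    regroup : ∀ v z u i → v * (z ^ k * (u * z ^ i)) ≈ u * (v * z ^ (k ℕ.+ i))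
    regroup v z u i = trans
      (solve 4 (λ v p u q → v :* (p :* (u :* q)) := u :* (v :* (p :* q))) refl v (z ^ k) u (z ^ i))
      (*-congˡ (*-congˡ (sym (^-homo-* z k i))))

  δ₀ : ℕ → Carrier
  δ₀ zero    = 1#
  δ₀ (suc _) = 0#

  δ₀-∸ : ∀ {m n} → m < n → δ₀ (n ∸ m) ≡ 0#
  δ₀-∸ {zero}  {suc n} _         = ≡.refl
  δ₀-∸ {suc m} {suc n} (s≤s m<n) = δ₀-∸ m<n

  record Impulse (lam T : ℕ) (s : ℕ → Carrier) : Set ℓ where
    field
      below : ∀ {m} → m < T → s m ≈ 0#
      at    : s T ≈ 1#
      above : ∀ {m} → T < m → m ≤ T ℕ.+ lam → s m ≈ 0#

  module _ (isField : IsField) where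
    open IsField isField

    x*y≈0⇒y≈0 : ∀ {x y} → x ≉ 0# → x * y ≈ 0# → y ≈ 0#
    x*y≈0⇒y≈0 {x} {y} x≉0 xy≈0 = let (x⁻¹ , xx⁻¹≈1) = inverse x x≉0 in begin
      y              ≈⟨ *-identityˡ y ⟨
      1# * y         ≈⟨ *-congʳ xx⁻¹≈1 ⟨
      (x * x⁻¹) * y  ≈⟨ solve 3 (λ x x⁻¹ y → (x :* x⁻¹) :* y := x⁻¹ :* (x :* y)) refl x x⁻¹ y ⟩
      x⁻¹ * (x * y)  ≈⟨ y≈0⇒x*y≈0 x⁻¹ xy≈0 ⟩
      0#             ∎

    *-≉0 : ∀ {x y} → x ≉ 0# → y ≉ 0# → x * y ≉ 0#
    *-≉0 x≉0 y≉0 xy≈0 = y≉0 (x*y≈0⇒y≈0 x≉0 xy≈0)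

    prodFin-≉0 : ∀ n {g : Fin n → Carrier} → (∀ i → g i ≉ 0#) → prodFin n g ≉ 0#
    prodFin-≉0 zero    g≉0 1≈0 = 0≉1 (sym 1≈0)
    prodFin-≉0 (suc n) g≉0     = *-≉0 (g≉0 zero) (prodFin-≉0 n (g≉0 ∘ suc))

    invertible⇒≉0 : ∀ {x y} → x * y ≈ 1# → x ≉ 0#
    invertible⇒≉0 {x} {y} xy≈1 x≈0 = 0≉1 (trans (sym (x≈0⇒x*y≈0 y x≈0)) xy≈1)

    x≉y⇒x-y≉0 : ∀ {x y} → x ≉ y → x - y ≉ 0#
    x≉y⇒x-y≉0 {x} {y} x≉y x-y≈0 = x≉y (x∙y⁻¹≈ε⇒x≈y x y x-y≈0)

    x*z≈y*z⇒z≈0 : ∀ {x y z} → x ≉ y → x * z ≈ y * z → z ≈ 0#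
    x*z≈y*z⇒z≈0 {x} {y} {z} x≉y xz≈yz = x*y≈0⇒y≈0 (x≉y⇒x-y≉0 x≉y) (begin
      (x - y) * z        ≈⟨ distribʳ z x (- y) ⟩
      x * z + - y * z    ≈⟨ +-congˡ (sym (-‿distribˡ-* y z)) ⟩
      x * z - y * z      ≈⟨ x≈y⇒x∙y⁻¹≈ε xz≈yz ⟩
      0#                 ∎)

    -- Peeling off x, or (after swapping the first two points) y, gives x S = y S for the zeroth power sum S.
    powerSum-zero : ∀ x B w → Distinct (x ∷ B) → IsLagrangeWeight (x ∷ B) w →
      powerSum (x ∷ B) w 0 ≈ δ₀ (length B)
    powerSum-zero x []      w _ wt = trans (+-identityʳ _) (wt zero)
    powerSum-zero x (y ∷ C) w ((x≉y ∷ x≉C) ∷ y≉C ∷ distinctC) wt =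
      x*z≈y*z⇒z≈0 x≉y (∙-cancelʳ _ _ _ (trans (sym viaX) viaY))
      where
      viaX : powerSum (x ∷ y ∷ C) w 1 ≈ x * powerSum (x ∷ y ∷ C) w 0 + δ₀ (length C)
      viaX = trans (powerSum-suc x (y ∷ C) w 0)
        (+-congˡ (powerSum-zero y C _ (y≉C ∷ distinctC) (tailWeights-isLagrange wt)))
      viaY : powerSum (x ∷ y ∷ C) w 1 ≈ y * powerSum (x ∷ y ∷ C) w 0 + δ₀ (length C)
      viaY = begin
        powerSum (x ∷ y ∷ C) w 1
          ≈⟨ powerSum-swap₀₁ x y C w 1 ⟨
        powerSum (y ∷ x ∷ C) (swap₀₁ w) 1
          ≈⟨ powerSum-suc y (x ∷ C) (swap₀₁ w) 0 ⟩
        y * powerSum (y ∷ x ∷ C) (swap₀₁ w) 0 + powerSum (x ∷ C) (tailWeights y (x ∷ C) (swap₀₁ w)) 0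
          ≈⟨ +-cong (*-congˡ (powerSum-swap₀₁ x y C w 0))
                    (powerSum-zero x C _ (x≉C ∷ distinctC) (tailWeights-isLagrange (swap₀₁-isLagrange wt))) ⟩
        y * powerSum (x ∷ y ∷ C) w 0 + δ₀ (length C) ∎

    powerSum-below : ∀ x B w → Distinct (x ∷ B) → IsLagrangeWeight (x ∷ B) w →
      ∀ {m} → m ≤ length B → powerSum (x ∷ B) w m ≈ δ₀ (length B ∸ m)
    powerSum-below x B       w distinct wt {zero}  _         = powerSum-zero x B w distinct wt
    powerSum-below x (y ∷ C) w distinct@(_ ∷ distinctB) wt {suc m} (s≤s m≤C) = begin
      powerSum (x ∷ y ∷ C) w (suc m)
        ≈⟨ powerSum-suc x (y ∷ C) w m ⟩
      x * powerSum (x ∷ y ∷ C) w m + powerSum (y ∷ C) (tailWeights x (y ∷ C) w) m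
        ≈⟨ +-cong (y≈0⇒x*y≈0 x (trans (powerSum-below x (y ∷ C) w distinct wt (ℕₚ.m≤n⇒m≤1+n m≤C))
                                         (reflexive (δ₀-∸ (s≤s m≤C)))))
                  (powerSum-below y C _ distinctB (tailWeights-isLagrange wt) m≤C) ⟩
      0# + δ₀ (length C ∸ m)
        ≈⟨ +-identityˡ _ ⟩
      δ₀ (length C ∸ m) ∎

    -- In 0 = Σ_a w(a) a^k Π_A(a) the leading coefficient 1 of Π_A meets S(k + N); every other term
    -- has a vanishing coefficient (nullity) or a vanishing power sum (powerSum-below).
    powerSum-nullRange : ∀ {lam} x B w → Distinct (x ∷ B) → IsLagrangeWeight (x ∷ B) w → IsNull lam (x ∷ B) →
      ∀ {k} → k < lam → powerSum (x ∷ B) w (k ℕ.+ suc (length B)) ≈ 0#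
    powerSum-nullRange {lam} x B w distinct wt null@(_ , lam≤N , _) {k} k<lam = begin
      S (k ℕ.+ N)
        ≈⟨ *-identityˡ _ ⟨
      1# * S (k ℕ.+ N)
        ≈⟨ *-congʳ (ucoeff-ΠA-length A) ⟨
      term N
        ≈⟨ +-identityˡ _ ⟨
      0# + term N
        ≈⟨ +-congʳ (sum-≈0 {N} (term ∘ toℕ) lowTerm) ⟨
      ∑[ i < N ] term (toℕ i) + term N
        ≈⟨ +-cong (sum-cong-≋ {N} (λ i → reflexive (≡.cong term (Finₚ.toℕ-inject₁ i))))
                  (reflexive (≡.cong term (Finₚ.toℕ-fromℕ N))) ⟨
      ∑[ i < N ] term (toℕ (inject₁ i)) + term (toℕ (fromℕ N))
        ≈⟨ sum-init-last {N} (term ∘ toℕ) ⟨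
      ∑[ i < suc N ] term (toℕ i)
        ≈⟨ powerSum-ueval A w k (ΠA A) (ℕₚ.≤-reflexive (length-ΠA A)) ⟨
      ∑[ j < N ] (w j * (lookup A j ^ k * ueval (ΠA A) (lookup A j)))
        ≈⟨ sum-≈0 {N} _ (λ j → y≈0⇒x*y≈0 (w j) (y≈0⇒x*y≈0 (lookup A j ^ k) (ueval-ΠA-lookup A j))) ⟩
      0# ∎
      where
      A = x ∷ B
      N = length A
      S = powerSum A w
      term : ℕ → Carrier
      term i = ucoeff (ΠA A) i * S (k ℕ.+ i)
      lowTerm : ∀ (i : Fin N) → term (toℕ i) ≈ 0#
      lowTerm i with N ∸ lam ℕ.≤? toℕ i
      ... | yes N∸lam≤i = x≈0⇒x*y≈0 _ (nullCoefficient A null N∸lam≤i (Finₚ.toℕ<n i))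
      ... | no  N∸lam≰i =
        y≈0⇒x*y≈0 _ (trans (powerSum-below x B w distinct wt (ℕₚ.<⇒≤ k+i<B)) (reflexive (δ₀-∸ k+i<B)))
        where
        k+i<B : k ℕ.+ toℕ i < length B
        k+i<B = ≡.subst (_≤ length B) (ℕₚ.+-suc k (toℕ i)) (ℕ.s≤s⁻¹
                  (≡.subst (suc k ℕ.+ suc (toℕ i) ≤_) (ℕₚ.m+[n∸m]≡n lam≤N) (ℕₚ.+-mono-≤ k<lam (ℕₚ.≰⇒> N∸lam≰i))))

    powerSum-impulse : ∀ {lam} A w → Distinct A → IsLagrangeWeight A w → IsNull lam A →
      Impulse lam (length A ∸ 1) (powerSum A w)
    powerSum-impulse []      w _        _  (A≢[] , _) = ⊥-elim (A≢[] ≡.refl)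
    powerSum-impulse {lam} (x ∷ B) w distinct wt null = record
      { below = λ m<B → trans (below (ℕₚ.<⇒≤ m<B)) (reflexive (δ₀-∸ m<B))
      ; at    = trans (below ℕₚ.≤-refl) (reflexive (≡.cong δ₀ (ℕₚ.n∸n≡0 (length B))))
      ; above = above
      }
      where
      below : ∀ {m} → m ≤ length B → powerSum (x ∷ B) w m ≈ δ₀ (length B ∸ m)
      below = powerSum-below x B w distinct wt
      above : ∀ {m} → length B < m → m ≤ length B ℕ.+ lam → powerSum (x ∷ B) w m ≈ 0#
      above {m} B<m m≤B+lam = ≡.subst (λ t → powerSum (x ∷ B) w t ≈ 0#) (ℕₚ.m∸n+n≡m B<m)
                                      (powerSum-nullRange x B w distinct wt null k<lam)
        where
        k = m ∸ suc (length B)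
        B+1+k≡m : length B ℕ.+ suc k ≡ m
        B+1+k≡m = ≡.trans (ℕₚ.+-comm (length B) (suc k))
                          (≡.trans (≡.sym (ℕₚ.+-suc k (length B))) (ℕₚ.m∸n+n≡m B<m))
        k<lam : k < lam
        k<lam = ℕₚ.+-cancelˡ-≤ (length B) (suc k) lam
                  (≡.subst (_≤ length B ℕ.+ lam) (≡.sym B+1+k≡m) m≤B+lam)

    lagrangeWeights : ∀ A → Distinct A → Σ (Fin (length A) → Carrier) (IsLagrangeWeight A)
    lagrangeWeights A distinct =
      (λ j → proj₁ (denominator⁻¹ j)) , (λ j → trans (*-comm _ _) (proj₂ (denominator⁻¹ j)))
      where
      denominator⁻¹ : ∀ j → ∃[ y ] (lagrangeDenominator A j * y ≈ 1#)
      denominator⁻¹ j = inverse _ (prodFin-≉0 _ (λ k → x≉y⇒x-y≉0 (lookup-≉-removeAt A distinct j k)))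

  -- Linear functionals on polynomials

  termSum : ∀ {n} → Poly n → (Vec ℕ n → Carrier) → Carrier
  termSum []            H = 0#
  termSum ((a , e) ∷ f) H = a * H e + termSum f H

  termSum-cong : ∀ {n} (f : Poly n) {H₁ H₂ : Vec ℕ n → Carrier} →
    (∀ e → H₁ e ≈ H₂ e) → termSum f H₁ ≈ termSum f H₂
  termSum-cong []            H₁≈H₂ = refl
  termSum-cong ((a , e) ∷ f) H₁≈H₂ = +-cong (*-congˡ (H₁≈H₂ e)) (termSum-cong f H₁≈H₂)

  termSum-*ˡ : ∀ {n} (f : Poly n) x H → x * termSum f H ≈ termSum f (λ e → x * H e)
  termSum-*ˡ []            x H = zeroʳ x
  termSum-*ˡ ((a , e) ∷ f) x H = trans (distribˡ x _ _) (+-cong (x∙yz≈y∙xz x a (H e)) (termSum-*ˡ f x H))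

  monomial : ∀ {n} → (Fin n → Carrier) → Vec ℕ n → Carrier
  monomial {n} x e = prodFin n (λ i → x i ^ Vec.lookup e i)

  eval≡termSum : ∀ {n} (f : Poly n) x → eval f x ≡ termSum f (monomial x)
  eval≡termSum []            x = ≡.refl
  eval≡termSum ((a , e) ∷ f) x = ≡.cong (a * monomial x e +_) (eval≡termSum f x)

  eval-cong : ∀ {n} (f : Poly n) {x y : Fin n → Carrier} → (∀ i → x i ≈ y i) → eval f x ≈ eval f y
  eval-cong []                x≈y = refl
  eval-cong {n} ((a , e) ∷ f) x≈y =
    +-cong (*-congˡ (prodFin-cong n (λ i → ^-congˡ (Vec.lookup e i) (x≈y i)))) (eval-cong f x≈y)

  indicator : ∀ {n} → Vec ℕ n → Vec ℕ n → Carrier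
  indicator t e with ≡-dec ℕ._≟_ e t
  ... | yes _ = 1#
  ... | no  _ = 0#

  termSum-indicator : ∀ {n} (f : Poly n) t → termSum f (indicator t) ≈ coeff f t
  termSum-indicator []            t = refl
  termSum-indicator ((a , e) ∷ f) t with ≡-dec ℕ._≟_ e t
  ... | yes _ = +-cong (*-identityʳ a) (termSum-indicator f t)
  ... | no  _ = trans (+-cong (zeroʳ a) (termSum-indicator f t)) (+-identityˡ _)

  dropMonomial : ∀ {n} → Vec ℕ n → Poly n → Poly n
  dropMonomial e₀ []            = []
  dropMonomial e₀ ((a , e) ∷ f) with ≡-dec ℕ._≟_ e e₀
  ... | yes _ = dropMonomial e₀ f
  ... | no  _ = (a , e) ∷ dropMonomial e₀ f

  length-dropMonomial : ∀ {n} e₀ (f : Poly n) → length (dropMonomial e₀ f) ≤ length f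
  length-dropMonomial e₀ []            = z≤n
  length-dropMonomial e₀ ((a , e) ∷ f) with ≡-dec ℕ._≟_ e e₀
  ... | yes _ = ℕₚ.m≤n⇒m≤1+n (length-dropMonomial e₀ f)
  ... | no  _ = s≤s (length-dropMonomial e₀ f)

  coeff-∷-≡ : ∀ {n} a (e : Vec ℕ n) f → coeff ((a , e) ∷ f) e ≈ a + coeff f e
  coeff-∷-≡ a e f with ≡-dec ℕ._≟_ e e
  ... | yes _   = refl
  ... | no  e≢e = contradiction ≡.refl e≢e

  coeff-∷-≢ : ∀ {n} a {e m : Vec ℕ n} f → e ≢ m → coeff ((a , e) ∷ f) m ≈ coeff f m
  coeff-∷-≢ a {e} {m} f e≢m with ≡-dec ℕ._≟_ e m
  ... | yes e≡m = contradiction e≡m e≢m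
  ... | no  _   = refl

  coeff-dropMonomial-≡ : ∀ {n} e₀ (f : Poly n) → coeff (dropMonomial e₀ f) e₀ ≈ 0#
  coeff-dropMonomial-≡ e₀ []            = refl
  coeff-dropMonomial-≡ e₀ ((a , e) ∷ f) with ≡-dec ℕ._≟_ e e₀
  ... | yes _   = coeff-dropMonomial-≡ e₀ f
  ... | no  e≢e₀ = trans (coeff-∷-≢ a (dropMonomial e₀ f) e≢e₀) (coeff-dropMonomial-≡ e₀ f)

  coeff-dropMonomial-≢ : ∀ {n} {e₀ m} (f : Poly n) → m ≢ e₀ → coeff (dropMonomial e₀ f) m ≈ coeff f m
  coeff-dropMonomial-≢ {e₀ = e₀} {m} []            m≢e₀ = refl
  coeff-dropMonomial-≢ {e₀ = e₀} {m} ((a , e) ∷ f) m≢e₀ with ≡-dec ℕ._≟_ e e₀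
  ... | yes e≡e₀ =
    trans (coeff-dropMonomial-≢ f m≢e₀) (sym (coeff-∷-≢ a f (λ e≡m → m≢e₀ (≡.trans (≡.sym e≡m) e≡e₀))))
  ... | no  _ with ≡-dec ℕ._≟_ e m
  ...   | yes _ = +-congˡ (coeff-dropMonomial-≢ f m≢e₀)
  ...   | no  _ = coeff-dropMonomial-≢ f m≢e₀

  termSum-dropMonomial : ∀ {n} e₀ (f : Poly n) H →
    termSum f H ≈ coeff f e₀ * H e₀ + termSum (dropMonomial e₀ f) H
  termSum-dropMonomial e₀ []            H = sym (trans (+-congʳ (zeroˡ _)) (+-identityˡ 0#))
  termSum-dropMonomial e₀ ((a , e) ∷ f) H with ≡-dec ℕ._≟_ e e₀
  ... | yes ≡.refl = trans (+-congˡ (termSum-dropMonomial e f H))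
    (solve 4 (λ a c h r → a :* h :+ (c :* h :+ r) := (a :+ c) :* h :+ r) refl a (coeff f e) (H e) _)
  ... | no  _      = trans (+-congˡ (termSum-dropMonomial e₀ f H))
    (solve 3 (λ x y z → x :+ (y :+ z) := y :+ (x :+ z)) refl (a * H e) (coeff f e₀ * H e₀) _)

  DegLe-dropMonomial : ∀ {n} a (e : Vec ℕ n) f {D} → DegLe ((a , e) ∷ f) D → DegLe (dropMonomial e f) D
  DegLe-dropMonomial a e f deg m c≉0 with ≡-dec ℕ._≟_ m e
  ... | yes ≡.refl = contradiction (coeff-dropMonomial-≡ m f) c≉0
  ... | no  m≢e    = deg m (λ c≈0 → c≉0 (trans (coeff-dropMonomial-≢ f m≢e)
                                        (trans (sym (coeff-∷-≢ a f (m≢e ∘ ≡.sym))) c≈0)))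

  termSum-¬¬cong-lowDegree : ∀ {n} D (f : Poly n) {H₁ H₂ : Vec ℕ n → Carrier} → DegLe f D →
    (∀ e → mdeg e ≤ D → H₁ e ≈ H₂ e) → ¬ ¬ (termSum f H₁ ≈ termSum f H₂)
  termSum-¬¬cong-lowDegree D f {H₁} {H₂} deg H₁≈H₂ = go (length f) f ℕₚ.≤-refl deg
    where
    go : ∀ k f → length f ≤ k → DegLe f D → ¬ ¬ (termSum f H₁ ≈ termSum f H₂)
    go k       []             _           _   = pure refl
    go (suc k) f@((a , e) ∷ f′) (s≤s len≤k) deg = zipWith combine headTerm
      (go k (dropMonomial e f′) (ℕₚ.≤-trans (length-dropMonomial e f′) len≤k) (DegLe-dropMonomial a e f′ deg))
      where
      headTerm : ¬ ¬ (coeff f e * H₁ e ≈ coeff f e * H₂ e)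
      headTerm with mdeg e ℕ.≤? D
      ... | yes e≤D = pure (*-congˡ (H₁≈H₂ e e≤D))
      ... | no  e≰D = (λ c≈0 → trans (x≈0⇒x*y≈0 _ c≈0) (sym (x≈0⇒x*y≈0 _ c≈0))) <$> (λ c≉0 → e≰D (deg e c≉0))
      split : ∀ H → termSum f H ≈ coeff f e * H e + termSum (dropMonomial e f′) H
      split H = begin
        a * H e + termSum f′ H                                        ≈⟨ +-congˡ (termSum-dropMonomial e f′ H) ⟩
        a * H e + (coeff f′ e * H e + termSum (dropMonomial e f′) H)  ≈⟨ +-assoc _ _ _ ⟨
        (a * H e + coeff f′ e * H e) + termSum (dropMonomial e f′) H  ≈⟨ +-congʳ (distribʳ (H e) a _) ⟨
        (a + coeff f′ e) * H e + termSum (dropMonomial e f′) H        ≈⟨ +-congʳ (*-congʳ (coeff-∷-≡ a e f′)) ⟨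
        coeff f e * H e + termSum (dropMonomial e f′) H               ∎
      combine : coeff f e * H₁ e ≈ coeff f e * H₂ e →
        termSum (dropMonomial e f′) H₁ ≈ termSum (dropMonomial e f′) H₂ → termSum f H₁ ≈ termSum f H₂
      combine head rest = trans (split H₁) (trans (+-cong head rest) (sym (split H₂)))

  -- Grid sums

  Choices : ∀ {n} → (Fin n → ℕ) → Set
  Choices {n} M = (i : Fin n) → Fin (M i)

  _◂_ : ∀ {n} {M : Fin (suc n) → ℕ} → Fin (M zero) → Choices (M ∘ suc) → Choices M
  (j ◂ τ) zero    = j
  (j ◂ τ) (suc i) = τ i

  gridSum : ∀ {n} (M : Fin n → ℕ) → (Choices M → Carrier) → Carrier
  gridSum {zero}  M g = g (λ ())
  gridSum {suc n} M g = ∑[ j < M zero ] gridSum (M ∘ suc) (λ τ → g (j ◂ τ))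

  gridSum-cong : ∀ {n} (M : Fin n → ℕ) {g h : Choices M → Carrier} →
    (∀ σ → g σ ≈ h σ) → gridSum M g ≈ gridSum M h
  gridSum-cong {zero}  M g≈h = g≈h _
  gridSum-cong {suc n} M g≈h = sum-cong-≋ {M zero} (λ j → gridSum-cong (M ∘ suc) (λ τ → g≈h (j ◂ τ)))

  gridSum-*ˡ : ∀ {n} (M : Fin n → ℕ) x (g : Choices M → Carrier) →
    x * gridSum M g ≈ gridSum M (λ σ → x * g σ)
  gridSum-*ˡ {zero}  M x g = refl
  gridSum-*ˡ {suc n} M x g = trans (*-distribˡ-sum {M zero} x _)
    (sum-cong-≋ {M zero} (λ j → gridSum-*ˡ (M ∘ suc) x (λ τ → g (j ◂ τ))))

  gridSum-+ : ∀ {n} (M : Fin n → ℕ) (g h : Choices M → Carrier) →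
    gridSum M (λ σ → g σ + h σ) ≈ gridSum M g + gridSum M h
  gridSum-+ {zero}  M g h = refl
  gridSum-+ {suc n} M g h = trans
    (sum-cong-≋ {M zero} (λ j → gridSum-+ (M ∘ suc) (λ τ → g (j ◂ τ)) (λ τ → h (j ◂ τ))))
    (∑-distrib-+ {M zero} _ _)

  gridSum-prodFin : ∀ {n} (M : Fin n → ℕ) (h : (i : Fin n) → Fin (M i) → Carrier) →
    gridSum M (λ σ → prodFin n (λ i → h i (σ i))) ≈ prodFin n (λ i → ∑[ j < M i ] h i j)
  gridSum-prodFin {zero}  M h = refl
  gridSum-prodFin {suc n} M h = begin
    ∑[ j < M zero ] gridSum (M ∘ suc) (λ τ → h zero j * prodFin n (λ i → h (suc i) (τ i)))
      ≈⟨ sum-cong-≋ {M zero} (λ j → gridSum-*ˡ (M ∘ suc) (h zero j) _) ⟨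
    ∑[ j < M zero ] (h zero j * gridSum (M ∘ suc) (λ τ → prodFin n (λ i → h (suc i) (τ i))))
      ≈⟨ sum-cong-≋ {M zero} (λ j → *-congˡ (gridSum-prodFin (M ∘ suc) (h ∘ suc))) ⟩
    ∑[ j < M zero ] (h zero j * prodFin n (λ i → ∑[ j < M (suc i) ] h (suc i) j))
      ≈⟨ *-distribʳ-sum {M zero} _ (h zero) ⟨
    (∑[ j < M zero ] h zero j) * prodFin n (λ i → ∑[ j < M (suc i) ] h (suc i) j) ∎

  ¬¬-∀-Fin : ∀ {n} {P : Fin n → Set ℓ} → (∀ i → ¬ ¬ P i) → ¬ ¬ (∀ i → P i)
  ¬¬-∀-Fin {zero}  ¬¬P = pure (λ ())
  ¬¬-∀-Fin {suc n} ¬¬P =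
    zipWith (λ { P₀ P₊ zero → P₀ ; P₀ P₊ (suc i) → P₊ i }) (¬¬P zero) (¬¬-∀-Fin (¬¬P ∘ suc))

  sum-¬¬≈0 : ∀ {n} (t : Fin n → Carrier) → (∀ i → ¬ ¬ (t i ≈ 0#)) → ¬ ¬ (sum t ≈ 0#)
  sum-¬¬≈0 t ¬¬t≈0 = sum-≈0 t <$> ¬¬-∀-Fin ¬¬t≈0

  sum-¬¬≈single : ∀ {n} (t : Fin n → Carrier) i → (∀ j → j ≢ i → ¬ ¬ (t j ≈ 0#)) → ¬ ¬ (sum t ≈ t i)
  sum-¬¬≈single {suc n} t i ¬¬t≈0 =
    (λ others≈0 → trans (sum-remove t) (trans (+-congˡ others≈0) (+-identityʳ (t i))))
      <$> sum-¬¬≈0 (t ∘ punchIn i) (λ k → ¬¬t≈0 (punchIn i k) (Finₚ.punchInᵢ≢i i k))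

  gridSum-¬¬≈0 : ∀ {n} (M : Fin n → ℕ) (g : Choices M → Carrier) →
    (∀ σ → ¬ ¬ (g σ ≈ 0#)) → ¬ ¬ (gridSum M g ≈ 0#)
  gridSum-¬¬≈0 {zero}  M g ¬¬g≈0 = ¬¬g≈0 _
  gridSum-¬¬≈0 {suc n} M g ¬¬g≈0 = sum-¬¬≈0 _ (λ j → gridSum-¬¬≈0 (M ∘ suc) _ (λ τ → ¬¬g≈0 (j ◂ τ)))

  gridSum-¬¬≈single : ∀ {n} (M : Fin n → ℕ) (g : Choices M → Carrier) (σ₀ : Choices M) →
    (∀ σ → (∀ i → σ i ≡ σ₀ i) → g σ ≈ g σ₀) → (∀ σ → ¬ (∀ i → σ i ≡ σ₀ i) → ¬ ¬ (g σ ≈ 0#)) →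
    ¬ ¬ (gridSum M g ≈ g σ₀)
  gridSum-¬¬≈single {zero}  M g σ₀ g-cong ¬¬g≈0 = pure (g-cong _ (λ ()))
  gridSum-¬¬≈single {suc n} M g σ₀ g-cong ¬¬g≈0 = zipWith trans
    (sum-¬¬≈single _ (σ₀ zero) λ j j≢σ₀ →
       gridSum-¬¬≈0 (M ∘ suc) _ (λ τ → ¬¬g≈0 (j ◂ τ) (λ eq → j≢σ₀ (eq zero))))
    ((λ inner → trans inner (g-cong _ (σ₀◂ λ _ → ≡.refl))) <$>
       gridSum-¬¬≈single (M ∘ suc) (λ τ → g (σ₀ zero ◂ τ)) (σ₀ ∘ suc)
         (λ τ τ≡ → trans (g-cong _ (σ₀◂ τ≡)) (sym (g-cong _ (σ₀◂ λ _ → ≡.refl))))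
         (λ τ τ≢ → ¬¬g≈0 _ (λ eq → τ≢ (eq ∘ suc))))
    where
    σ₀◂ : ∀ {τ} → (∀ i → τ i ≡ σ₀ (suc i)) → ∀ i → (σ₀ zero ◂ τ) i ≡ σ₀ i
    σ₀◂ τ≡ zero    = ≡.refl
    σ₀◂ τ≡ (suc i) = τ≡ i

  gridSum-termSum : ∀ {n k} (M : Fin k → ℕ) (f : Poly n) (H : Choices M → Vec ℕ n → Carrier) →
    gridSum M (λ σ → termSum f (H σ)) ≈ termSum f (λ e → gridSum M (λ σ → H σ e))
  gridSum-termSum M []            H = begin
    gridSum M (λ _ → 0#)       ≈⟨ gridSum-cong M (λ _ → zeroˡ 0#) ⟨
    gridSum M (λ _ → 0# * 0#)  ≈⟨ gridSum-*ˡ M 0# (λ _ → 0#) ⟨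
    0# * gridSum M (λ _ → 0#)  ≈⟨ zeroˡ _ ⟩
    0#                         ∎
  gridSum-termSum M ((a , e) ∷ f) H = begin
    gridSum M (λ σ → a * H σ e + termSum f (H σ))
      ≈⟨ gridSum-+ M _ _ ⟩
    gridSum M (λ σ → a * H σ e) + gridSum M (λ σ → termSum f (H σ))
      ≈⟨ +-cong (sym (gridSum-*ˡ M a _)) (gridSum-termSum M f H) ⟩
    a * gridSum M (λ σ → H σ e) + termSum f (λ e → gridSum M (λ σ → H σ e)) ∎

  weightedValue : ∀ {n} {M : Fin n → ℕ} (v p : (i : Fin n) → Fin (M i) → Carrier) →
    Poly n → Choices M → Carrier
  weightedValue {n} v p f σ = prodFin n (λ i → v i (σ i)) * eval f (λ i → p i (σ i))

  weightedValue-cong : ∀ {n} {M : Fin n → ℕ} (v p : (i : Fin n) → Fin (M i) → Carrier) f {σ τ : Choices M} →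
    (∀ i → σ i ≡ τ i) → weightedValue v p f σ ≈ weightedValue v p f τ
  weightedValue-cong {n} v p f σ≡τ = *-cong (prodFin-cong n (λ i → reflexive (≡.cong (v i) (σ≡τ i))))
                                             (eval-cong f (λ i → reflexive (≡.cong (p i) (σ≡τ i))))

  gridSum-weightedValue : ∀ {n} (M : Fin n → ℕ) (v p : (i : Fin n) → Fin (M i) → Carrier) (f : Poly n) →
    gridSum M (weightedValue v p f)
      ≈ termSum f (λ e → prodFin n (λ i → ∑[ j < M i ] (v i j * p i j ^ Vec.lookup e i)))
  gridSum-weightedValue {n} M v p f = begin
    gridSum M (λ σ → V σ * eval f (P σ))
      ≈⟨ gridSum-cong M (λ σ → *-congˡ (reflexive (eval≡termSum f (P σ)))) ⟩
    gridSum M (λ σ → V σ * termSum f (monomial (P σ)))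
      ≈⟨ gridSum-cong M (λ σ → termSum-*ˡ f (V σ) _) ⟩
    gridSum M (λ σ → termSum f (λ e → V σ * monomial (P σ) e))
      ≈⟨ gridSum-termSum M f _ ⟩
    termSum f (λ e → gridSum M (λ σ → V σ * monomial (P σ) e))
      ≈⟨ termSum-cong f (λ e → trans (gridSum-cong M (λ σ → prodFin-* n _ _)) (gridSum-prodFin M _)) ⟩
    termSum f (λ e → prodFin n (λ i → ∑[ j < M i ] (v i j * p i j ^ Vec.lookup e i))) ∎
    where
    V : Choices M → Carrier
    V σ = prodFin n (λ i → v i (σ i))
    P : Choices M → Fin n → Carrier
    P σ i = p i (σ i)

  module _ {lam : ℕ} where

    prodFin-belowTotal : ∀ {n} {T : Fin n → ℕ} {s : Fin n → ℕ → Carrier} → (∀ i → Impulse lam (T i) (s i)) →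
      ∀ e → mdeg e < sumFin n T → prodFin n (λ i → s i (Vec.lookup e i)) ≈ 0#
    prodFin-belowTotal {suc n} {T} imp (x ∷ e) x+e<T with x ℕ.<? T zero
    ... | yes x<T₀ = x≈0⇒x*y≈0 _ (Impulse.below (imp zero) x<T₀)
    ... | no  x≮T₀ = y≈0⇒x*y≈0 _ (prodFin-belowTotal (imp ∘ suc) e
        (ℕₚ.+-cancelˡ-< (T zero) _ _ (ℕₚ.≤-<-trans (ℕₚ.+-monoˡ-≤ (mdeg e) (ℕₚ.≮⇒≥ x≮T₀)) x+e<T)))

    prodFin-atTarget : ∀ {n} {T : Fin n → ℕ} {s : Fin n → ℕ → Carrier} → (∀ i → Impulse lam (T i) (s i)) →
      prodFin n (λ i → s i (Vec.lookup (tabulate T) i)) ≈ 1#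
    prodFin-atTarget {zero}  imp = refl
    prodFin-atTarget {suc n} imp =
      trans (*-cong (Impulse.at (imp zero)) (prodFin-atTarget (imp ∘ suc))) (*-identityˡ 1#)

    -- Off the target, some coordinate lies below its T i, or within lam above it; in the remaining case
    -- the excess over T i exceeds lam, pushing the other coordinates below their total.
    prodFin-offTarget : ∀ {n} {T : Fin n → ℕ} {s : Fin n → ℕ → Carrier} → (∀ i → Impulse lam (T i) (s i)) →
      ∀ e → mdeg e ≤ sumFin n T ℕ.+ lam → e ≢ tabulate T → prodFin n (λ i → s i (Vec.lookup e i)) ≈ 0#
    prodFin-offTarget {zero}          imp []      _     e≢T = contradiction ≡.refl e≢T
    prodFin-offTarget {suc n} {T} {s} imp (x ∷ e) x+e≤ e≢T with ℕₚ.<-cmp x (T zero)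
    ... | tri< x<T₀ _ _ = x≈0⇒x*y≈0 _ (Impulse.below (imp zero) x<T₀)
    ... | tri≈ _ ≡.refl _ = y≈0⇒x*y≈0 _ (prodFin-offTarget (imp ∘ suc) e
        (ℕₚ.+-cancelˡ-≤ x _ _ (≡.subst (x ℕ.+ mdeg e ≤_) (ℕₚ.+-assoc x (sumFin n (T ∘ suc)) lam) x+e≤))
        (e≢T ∘ ≡.cong (x ∷_)))
    ... | tri> _ _ T₀<x with x ℕ.≤? T zero ℕ.+ lam
    ...   | yes x≤T₀+lam = x≈0⇒x*y≈0 _ (Impulse.above (imp zero) T₀<x x≤T₀+lam)
    ...   | no  x≰T₀+lam = y≈0⇒x*y≈0 _ (prodFin-belowTotal (imp ∘ suc) e
        (ℕₚ.+-cancelˡ-< (T zero ℕ.+ lam) _ _ (ℕₚ.<-≤-trans (ℕₚ.+-monoˡ-< (mdeg e) (ℕₚ.≰⇒> x≰T₀+lam))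
          (≡.subst (x ℕ.+ mdeg e ≤_) (rearrange (T zero) (sumFin n (T ∘ suc)) lam) x+e≤))))
      where
      rearrange : ∀ a b c → a ℕ.+ b ℕ.+ c ≡ a ℕ.+ c ℕ.+ b
      rearrange a b c = ≡.trans (ℕₚ.+-assoc a b c)
                          (≡.trans (≡.cong (a ℕ.+_) (ℕₚ.+-comm b c)) (≡.sym (ℕₚ.+-assoc a c b)))

    prodFin-impulse : ∀ {n} {T : Fin n → ℕ} {s : Fin n → ℕ → Carrier} → (∀ i → Impulse lam (T i) (s i)) →
      ∀ e → mdeg e ≤ sumFin n T ℕ.+ lam → prodFin n (λ i → s i (Vec.lookup e i)) ≈ indicator (tabulate T) e
    prodFin-impulse {T = T} imp e e≤ with ≡-dec ℕ._≟_ e (tabulate T)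
    ... | yes ≡.refl = prodFin-atTarget imp
    ... | no  e≢T    = prodFin-offTarget imp e e≤ e≢T

open import Data.Nat using (_+_)

corollary6p4 : ∀ {c ℓ : Level} (R : CommutativeRing c ℓ) → FieldDefs.IsField R →
    (lam n : ℕ) (A : Fin n → List (CommutativeRing.Carrier R)) →
    (∀ i → FieldDefs.Distinct R (A i)) →
    (∀ i → FieldDefs.IsNull R lam (A i)) →
    (f : FieldDefs.Poly R n) →
    FieldDefs.DegLe R f (sumFin n (λ i → length (A i) ∸ 1) + lam) →
    CommutativeRing._≈_ R (FieldDefs.coeff R f (tabulate (λ i → length (A i) ∸ 1))) (CommutativeRing.0# R) →
    ¬ FieldDefs.ExactlyOneNonzero R A f
corollary6p4 R isField lam n A distinct null f deg target≈0 (σ₀ , f[σ₀]≉0 , nonzero⇒σ₀) =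
  concentrated λ grid≈g[σ₀] → vanishing λ grid≈0 → g[σ₀]≉0 (trans (sym grid≈g[σ₀]) grid≈0)
  where
  open CommutativeRing R using (Carrier; _≈_; 0#; trans; sym)
  open CoefficientFormula R

  M : Fin n → ℕ
  M i = length (A i)

  weights : ∀ i → Σ (Fin (M i) → Carrier) (IsLagrangeWeight (A i))
  weights i = lagrangeWeights isField (A i) (distinct i)

  w p : ∀ i → Fin (M i) → Carrier
  w i = proj₁ (weights i)
  p i = lookup (A i)

  g : Choices M → Carrier
  g = weightedValue w p f

  vanishing : ¬ ¬ (gridSum M g ≈ 0#)
  vanishing ¬grid≈0 = termSum-¬¬cong-lowDegree _ f deg
    (prodFin-impulse (λ i → powerSum-impulse isField (A i) (w i) (distinct i) (proj₂ (weights i)) (null i)))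
    (λ moment≈coeff → ¬grid≈0 (trans (gridSum-weightedValue M w p f)
                               (trans moment≈coeff (trans (termSum-indicator f _) target≈0))))

  concentrated : ¬ ¬ (gridSum M g ≈ g σ₀)
  concentrated = gridSum-¬¬≈single M g σ₀ (λ σ → weightedValue-cong w p f)
    (λ σ σ≢σ₀ ¬g[σ]≈0 → σ≢σ₀ (λ i → lookup-injective (A i) (distinct i)
                                      (nonzero⇒σ₀ σ (¬g[σ]≈0 ∘ y≈0⇒x*y≈0 _) i)))

  g[σ₀]≉0 : ¬ (g σ₀ ≈ 0#)
  g[σ₀]≉0 = *-≉0 isField (prodFin-≉0 isField n (λ i → invertible⇒≉0 isField (proj₂ (weights i) (σ₀ i))))
                  f[σ₀]≉0
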